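{- Let $G$ be a finite simple graph with vertices $v_1,\dots,v_n$, edges $e_1,\dots,e_m$ and maximum degree $\Delta$, and let $p\geq m^2(2\Delta+2)$ be a prime. Let $$\mathbf{P}(v_1,\dots,v_n,e_1,\dots,e_m)=\prod_{i=1}^{n}\Bigg(\prod_{v_j\in N_i(v_i)}(v_i-v_j)\prod_{e_j\in N_e(v_i)}(v_i-e_j)\prod_{l=\Delta+2}^{p}(v_i-l)\Bigg)\in\mathbb{Z}_p[v_1,\dots,v_n,e_1,\dots,e_m]$$ and let $\mathbf{P}'$ be its reduction. For any integers $l_1,\dots,l_n\ge 0$, let $\mathcal{C}^{\mathbf{P}'}(e_1,\dots,e_m)$ denote the coefficient of $\prod_{j=1}^n v_j^{l_j}$ in $\mathbf{P}'$ viewed as a polynomial in $v_1,\dots,v_n$ with coefficients in $\mathbb{Z}_p[e_1,\dots,e_m]$. Then for every $k$ with $1\le k\le m$, the exponent of $e_k$ in every monomial of $\mathcal{C}^{\mathbf{P}'}$ is at most $2$.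
   Context: $N(v_i)$ is the set of neighbours of $v_i$; $N_1(v_1)=N(v_1)$ and $N_i(v_i)=N(v_i)\setminus\{v_1,\dots,v_{i-1}\}$ for $i\ge 2$ (empty products equal $1$). $N_e(v_i)$ is the set of edges incident to $v_i$. Integers $l$ are taken modulo $p$. The reduction $F'$ of a polynomial $F$ over $\mathbb{Z}_p$ is obtained by repeatedly replacing $x^p$ by $x$ for every variable $x$, so all exponents in $F'$ are at most $p-1$. -}

module Defs where

open import Data.Nat as ℕ using (ℕ; zero; suc; _∸_; _≤?_; _<?_; _⊔_)
open import Data.Integer as ℤ using (ℤ; +_; -_)
open import Data.Fin using (Fin)
open import Data.Fin.Properties using (_≟_)
open import Data.Vec as Vec using (Vec; replicate; zipWith; _[_]≔_)
open import Data.Vec.Properties using (≡-dec)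
open import Data.List as List using (List; []; _∷_; _++_; map; concatMap; foldr; filter; allFin; upTo; length)
open import Data.Product using (_×_; _,_; proj₁; proj₂; Σ; ∃)
open import Data.Sum using (_⊎_)
open import Relation.Binary.PropositionalEquality using (_≡_; _≢_)
open import Relation.Nullary using (Dec; yes; no; ¬_)
open import Relation.Nullary.Decidable using (_×-dec_; _⊎-dec_; ⌊_⌋)
open import Data.Bool using (if_then_else_)

record SimpleGraph (n m : ℕ) : Set where
  field
    ends     : Fin m → Fin n × Fin n
    loopless : ∀ e → proj₁ (ends e) ≢ proj₂ (ends e)
    noMulti  : ∀ e e' →
      ((proj₁ (ends e) ≡ proj₁ (ends e') × proj₂ (ends e) ≡ proj₂ (ends e'))
       ⊎ (proj₁ (ends e) ≡ proj₂ (ends e') × proj₂ (ends e) ≡ proj₁ (ends e')))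
      → e ≡ e'

module _ {n m : ℕ} (G : SimpleGraph n m) where
  open SimpleGraph G

  incident? : (i : Fin n) (e : Fin m) → Dec (proj₁ (ends e) ≡ i ⊎ proj₂ (ends e) ≡ i)
  incident? i e = (proj₁ (ends e) ≟ i) ⊎-dec (proj₂ (ends e) ≟ i)

  joins? : (i j : Fin n) (e : Fin m) → Dec ((proj₁ (ends e) ≡ i × proj₂ (ends e) ≡ j)
                                          ⊎ (proj₁ (ends e) ≡ j × proj₂ (ends e) ≡ i))
  joins? i j e = ((proj₁ (ends e) ≟ i) ×-dec (proj₂ (ends e) ≟ j))
           ⊎-dec ((proj₁ (ends e) ≟ j) ×-dec (proj₂ (ends e) ≟ i))

  edgeNbhd : Fin n → List (Fin m)
  edgeNbhd i = filter (incident? i) (allFin m)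

  adjacent : Fin n → Fin n → Set
  adjacent i j = ∃ λ e → (proj₁ (ends e) ≡ i × proj₂ (ends e) ≡ j)
                        ⊎ (proj₁ (ends e) ≡ j × proj₂ (ends e) ≡ i)

  adjacent? : (i j : Fin n) → Dec (adjacent i j)
  adjacent? i j = Data.Fin.Properties.any? (joins? i j)

  nbhd : Fin n → List (Fin n)
  nbhd i = filter (adjacent? i) (allFin n)

  -- N_i(v_i) = N(v_i) \ {v_1, ..., v_{i-1}}  (i.e. neighbours v_j with j ≥ i)
  laterNbhd : Fin n → List (Fin n)
  laterNbhd i = filter (λ j → Data.Fin._≤?_ i j) (nbhd i)

  degree : Fin n → ℕ
  degree i = length (edgeNbhd i)

  maxDegree : ℕ
  maxDegree = foldr _⊔_ 0 (map degree (allFin n))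

-- Polynomials with integer coefficients in variables v_1..v_n, e_1..e_m,
-- represented as formal sums of terms  c · v^a e^b  (not normalised).
-- Coefficients are later read modulo the prime p, giving Z_p[...].

Mono : ℕ → ℕ → Set
Mono n m = Vec ℕ n × Vec ℕ m

Poly : ℕ → ℕ → Set
Poly n m = List (ℤ × Mono n m)

module _ {n m : ℕ} where

  oneP : Poly n m
  oneP = (+ 1 , replicate n 0 , replicate m 0) ∷ []

  constP : ℤ → Poly n m
  constP c = (c , replicate n 0 , replicate m 0) ∷ []

  varV : Fin n → Poly n m
  varV i = (+ 1 , (replicate n 0 [ i ]≔ 1) , replicate m 0) ∷ []

  varE : Fin m → Poly n m
  varE j = (+ 1 , replicate n 0 , (replicate m 0 [ j ]≔ 1)) ∷ []

  _+P_ : Poly n m → Poly n m → Poly n m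
  _+P_ = _++_

  negP : Poly n m → Poly n m
  negP = map (λ t → (- proj₁ t , proj₂ t))

  _-P_ : Poly n m → Poly n m → Poly n m
  f -P g = f +P negP g

  _*P_ : Poly n m → Poly n m → Poly n m
  f *P g = concatMap (λ s → map (λ t →
             ( proj₁ s ℤ.* proj₁ t
             , zipWith ℕ._+_ (proj₁ (proj₂ s)) (proj₁ (proj₂ t))
             , zipWith ℕ._+_ (proj₂ (proj₂ s)) (proj₂ (proj₂ t)))) g) f

  prodP : List (Poly n m) → Poly n m
  prodP = foldr _*P_ oneP

  monoEq? : (a b : Mono n m) → Dec (a ≡ b)
  monoEq? (a , b) (a' , b') with ≡-dec ℕ._≟_ a a' | ≡-dec ℕ._≟_ b b'
  ... | yes Relation.Binary.PropositionalEquality.refl | yes Relation.Binary.PropositionalEquality.refl = yes Relation.Binary.PropositionalEquality.refl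
  ... | no ¬p | _ = no λ { Relation.Binary.PropositionalEquality.refl → ¬p Relation.Binary.PropositionalEquality.refl }
  ... | yes _ | no ¬q = no λ { Relation.Binary.PropositionalEquality.refl → ¬q Relation.Binary.PropositionalEquality.refl }

  coeff : Poly n m → Mono n m → ℤ
  coeff f μ = foldr ℤ._+_ (+ 0) (map (λ t → if ⌊ monoEq? (proj₂ t) μ ⌋ then proj₁ t else + 0) f)

-- Reduction: repeatedly replace x^p by x, i.e. an exponent a ≥ p becomes
-- a - (p - 1), until it is < p.  (fuel a suffices since p ≥ 2.)

redExpAux : ℕ → ℕ → ℕ → ℕ
redExpAux p zero    a = a
redExpAux p (suc f) a with p ≤? a
... | yes _ = redExpAux p f (a ∸ (p ∸ 1))
... | no  _ = a

redExp : ℕ → ℕ → ℕ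
redExp p a = redExpAux p a a

reduce : {n m : ℕ} → ℕ → Poly n m → Poly n m
reduce p = map (λ t → (proj₁ t , Vec.map (redExp p) (proj₁ (proj₂ t))
                                , Vec.map (redExp p) (proj₂ (proj₂ t))))

module _ {n m : ℕ} (G : SimpleGraph n m) (p : ℕ) where

  vertexFactor : Fin n → Poly n m
  vertexFactor i =
    prodP (map (λ j → varV i -P varV j) (laterNbhd G i))
    *P (prodP (map (λ e → varV i -P varE e) (edgeNbhd G i))
    *P prodP (map (λ l → varV i -P constP (+ l))
                  (map (λ r → maxDegree G ℕ.+ 2 ℕ.+ r) (upTo (p ∸ (maxDegree G ℕ.+ 1))))))
    -- last product: l = Δ+2, ..., p

  bigP : Poly n m
  bigP = prodP (map vertexFactor (allFin n))

-- Each edge e_k occurs only in the two factors ∏_{e ∈ N_e(v_i)} (v_i − e) of its endpoints, and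
-- linearly there, so every term of P (expanded without collecting) has e_k-exponent at most 2.
-- The reduction x^p ↦ x only lowers exponents, so every monomial of P′ with e_k-exponent above 2
-- has coefficient 0.
module Submission where

open import Defs
open import Data.Nat using (ℕ; _*_; _+_; _≤_; _<_)
open import Data.Nat.Primality using (Prime)
open import Data.Integer using (+_)
open import Data.Integer.Divisibility using (_∣_)
open import Data.Fin using (Fin)
open import Data.Vec using (Vec; lookup)
open import Data.Product using (_,_)

open import Data.Bool using (true; false; if_then_else_)
open import Data.Empty using (⊥-elim)
open import Data.Fin using (zero; suc)
open import Data.Fin.Properties using (_≟_)
open import Data.Integer as ℤ using (ℤ)
open import Data.List using (List; []; _∷_; map; filter; tabulate; allFin; upTo)
open import Data.List.Properties using (map-tabulate)
open import Data.List.Relation.Unary.All as All using (All; []; _∷_)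
open import Data.List.Relation.Unary.All.Properties using (map⁺; ++⁺; concat⁺)
open import Data.Nat using (zero; suc; z≤n; s≤s; _≤?_; _∸_)
open import Data.Nat.Divisibility using (_∣0)
open import Data.Nat.ListAction using (sum)
open import Data.Nat.Properties
  using ( ≤-refl; ≤-reflexive; ≤-trans; <⇒≱; +-mono-≤; +-monoʳ-≤; m≤n+m; m∸n≤m; +-identityʳ
        ; +-commutativeSemigroup; module ≤-Reasoning)
open import Algebra.Properties.CommutativeSemigroup +-commutativeSemigroup using (interchange)
open import Data.Product using (_×_; proj₁; proj₂)
open import Data.Vec using (replicate; zipWith)
open import Data.Vec.Properties
  using (lookup-zipWith; lookup-replicate; lookup∘update; lookup∘update′; lookup-map)
open import Function using (_∘_)
open import Relation.Binary.PropositionalEquality using (_≡_; refl; sym; trans; cong; cong₂; subst)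
open import Relation.Nullary using (Dec; yes; no; does)
open import Relation.Nullary.Decidable using (_⊎-dec_)

indicator : ∀ {a} {A : Set a} → Dec A → ℕ
indicator a? = if does a? then 1 else 0

indicator-⊎-dec-≤ : ∀ {a b} {A : Set a} {B : Set b} (a? : Dec A) (b? : Dec B) →
                    indicator (a? ⊎-dec b?) ≤ indicator a? + indicator b?
indicator-⊎-dec-≤ (yes _) _       = s≤s z≤n
indicator-⊎-dec-≤ (no _)  (yes _) = ≤-refl
indicator-⊎-dec-≤ (no _)  (no _)  = z≤n

module _ {A : Set} where

  sum-map-mono-≤ : ∀ {f g : A → ℕ} → (∀ x → f x ≤ g x) → ∀ xs →
                   sum (map f xs) ≤ sum (map g xs)
  sum-map-mono-≤ f≤g []       = z≤n
  sum-map-mono-≤ f≤g (x ∷ xs) = +-mono-≤ (f≤g x) (sum-map-mono-≤ f≤g xs)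

  sum-map-+ : ∀ (f g : A → ℕ) xs →
              sum (map (λ x → f x + g x) xs) ≡ sum (map f xs) + sum (map g xs)
  sum-map-+ f g []       = refl
  sum-map-+ f g (x ∷ xs) =
    trans (cong (_+_ (f x + g x)) (sum-map-+ f g xs)) (interchange (f x) (g x) _ _)

  sum-map-filter-≤ : ∀ (f : A → ℕ) {P : A → Set} (P? : ∀ x → Dec (P x)) xs →
                     sum (map f (filter P? xs)) ≤ sum (map f xs)
  sum-map-filter-≤ f P? []       = z≤n
  sum-map-filter-≤ f P? (x ∷ xs) with does (P? x)
  ... | true  = +-monoʳ-≤ (f x) (sum-map-filter-≤ f P? xs)
  ... | false = ≤-trans (sum-map-filter-≤ f P? xs) (m≤n+m _ (f x))

sum-allFin-indicator-≟ : ∀ {N} (x : Fin N) → sum (map (λ i → indicator (x ≟ i)) (allFin N)) ≡ 1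
sum-allFin-indicator-≟ {N} x =
  trans (cong sum (map-tabulate {n = N} (λ i → i) (λ i → indicator (x ≟ i)))) (sum-tabulate x)
  where
  sum-tabulate-0 : ∀ N → sum (tabulate {n = N} (λ _ → 0)) ≡ 0
  sum-tabulate-0 zero    = refl
  sum-tabulate-0 (suc N) = sum-tabulate-0 N

  sum-tabulate : ∀ {N} (x : Fin N) → sum (tabulate (λ i → indicator (x ≟ i))) ≡ 1
  sum-tabulate {suc N} zero    = cong suc (sum-tabulate-0 N)
  sum-tabulate {suc N} (suc x) = sum-tabulate x

sum-allFin-indicator-filter-≤ : ∀ {N} (x : Fin N) {P : Fin N → Set} (P? : ∀ i → Dec (P i)) →
  sum (map (λ i → indicator (x ≟ i)) (filter P? (allFin N))) ≤ indicator (P? x)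
sum-allFin-indicator-filter-≤ {N} x P? with P? x
... | yes _ = ≤-trans (sum-map-filter-≤ _ P? (allFin N)) (≤-reflexive (sum-allFin-indicator-≟ x))
... | no ¬Px = ≤-reflexive (vanishes (allFin N))
  where
  vanishes : ∀ is → sum (map (λ i → indicator (x ≟ i)) (filter P? is)) ≡ 0
  vanishes []       = refl
  vanishes (i ∷ is) with P? i
  ... | no _ = vanishes is
  ... | yes Pi with x ≟ i
  ...   | yes refl = ⊥-elim (¬Px Pi)
  ...   | no _     = vanishes is

module _ {n m : ℕ} (k : Fin m) where

  eExponent : ℤ × Mono n m → ℕ
  eExponent t = lookup (proj₂ (proj₂ t)) k

  EDegreeAtMost : ℕ → Poly n m → Set
  EDegreeAtMost d = All (λ t → eExponent t ≤ d)

  eDegree-mono : ∀ {d e} {f : Poly n m} → d ≤ e → EDegreeAtMost d f → EDegreeAtMost e f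
  eDegree-mono d≤e = All.map (λ ≤d → ≤-trans ≤d d≤e)

  eDegree-constP : ∀ c → EDegreeAtMost 0 (constP c)
  eDegree-constP c = ≤-reflexive (lookup-replicate k 0) ∷ []

  eDegree-varV : ∀ i → EDegreeAtMost 0 (varV i)
  eDegree-varV i = ≤-reflexive (lookup-replicate k 0) ∷ []

  eDegree-varE : ∀ e → EDegreeAtMost (indicator (k ≟ e)) (varE e)
  eDegree-varE e with k ≟ e
  ... | yes refl = ≤-reflexive (lookup∘update k (replicate m 0) 1) ∷ []
  ... | no k≢e   = ≤-reflexive (trans (lookup∘update′ k≢e (replicate m 0) 1)
                                      (lookup-replicate k 0)) ∷ []

  eDegree--P : ∀ {d} {f g : Poly n m} → EDegreeAtMost d f → EDegreeAtMost d g →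
               EDegreeAtMost d (f -P g)
  eDegree--P degF degG = ++⁺ degF (map⁺ degG)

  eDegree-*P : ∀ {a b} {f g : Poly n m} → EDegreeAtMost a f → EDegreeAtMost b g →
               EDegreeAtMost (a + b) (f *P g)
  eDegree-*P {a} {b} {g = g} degF degG =
    concat⁺ (map⁺ {f = λ s → map (multiplyTerms s) g} (All.map (λ {s} → termwise {s}) degF))
    where
    multiplyTerms : ℤ × Mono n m → ℤ × Mono n m → ℤ × Mono n m
    multiplyTerms (c , α , β) (d , γ , δ) = c ℤ.* d , zipWith _+_ α γ , zipWith _+_ β δ

    termwise : ∀ {s} → eExponent s ≤ a → EDegreeAtMost (a + b) (map (multiplyTerms s) g)
    termwise {s} sa = map⁺ (All.map (λ {t} tb →
      ≤-trans (≤-reflexive (lookup-zipWith _+_ k (proj₂ (proj₂ s)) (proj₂ (proj₂ t))))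
              (+-mono-≤ sa tb)) degG)

  eDegree-prodP-map : ∀ {A : Set} (d : A → ℕ) (f : A → Poly n m) →
                      (∀ x → EDegreeAtMost (d x) (f x)) →
                      ∀ xs → EDegreeAtMost (sum (map d xs)) (prodP (map f xs))
  eDegree-prodP-map d f degF []       = ≤-reflexive (lookup-replicate k 0) ∷ []
  eDegree-prodP-map d f degF (x ∷ xs) = eDegree-*P (degF x) (eDegree-prodP-map d f degF xs)

  eDegree-prodP-0 : ∀ {A : Set} (f : A → Poly n m) → (∀ x → EDegreeAtMost 0 (f x)) →
                    ∀ xs → EDegreeAtMost 0 (prodP (map f xs))
  eDegree-prodP-0 f degF []       = ≤-reflexive (lookup-replicate k 0) ∷ []
  eDegree-prodP-0 f degF (x ∷ xs) = eDegree-*P (degF x) (eDegree-prodP-0 f degF xs)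

redExpAux-≤ : ∀ p fuel a → redExpAux p fuel a ≤ a
redExpAux-≤ p zero       a = ≤-refl
redExpAux-≤ p (suc fuel) a with p ≤? a
... | yes _ = ≤-trans (redExpAux-≤ p fuel (a ∸ (p ∸ 1))) (m∸n≤m a (p ∸ 1))
... | no  _ = ≤-refl

eDegree-reduce : ∀ {n m} (k : Fin m) p {d} {f : Poly n m} →
                 EDegreeAtMost k d f → EDegreeAtMost k d (reduce p f)
eDegree-reduce k p = map⁺ ∘ All.map (λ {t} ≤d →
  let a = eExponent k t in
  ≤-trans (≤-reflexive (lookup-map k (redExp p) (proj₂ (proj₂ t))))
          (≤-trans (redExpAux-≤ p a a) ≤d))

coeff-≡0 : ∀ {n m} (k : Fin m) {d} {f : Poly n m} → EDegreeAtMost k d f →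
           ∀ α β → d < lookup β k → coeff f (α , β) ≡ + 0
coeff-≡0 k []              α β d<βk = refl
coeff-≡0 k {f = t ∷ f} (≤d ∷ degF) α β d<βk with monoEq? (proj₂ t) (α , β)
... | yes refl = ⊥-elim (<⇒≱ d<βk ≤d)
... | no  _    = cong (ℤ._+_ (+ 0)) (coeff-≡0 k degF α β d<βk)

module _ {n m : ℕ} (G : SimpleGraph n m) (k : Fin m) where
  open SimpleGraph G

  edgeMultiplicity : Fin n → ℕ
  edgeMultiplicity i = sum (map (λ e → indicator (k ≟ e)) (edgeNbhd G i))

  eDegree-vertexFactor : ∀ p i → EDegreeAtMost k (edgeMultiplicity i) (vertexFactor G p i)
  eDegree-vertexFactor p i =
    eDegree-mono k (≤-reflexive (+-identityʳ _))
      (eDegree-*P k vertexPart (eDegree-*P k edgePart constantPart))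
    where
    thresholds : List ℕ
    thresholds = map (λ r → maxDegree G + 2 + r) (upTo (p ∸ (maxDegree G + 1)))


    vertexPart : EDegreeAtMost k 0 (prodP (map (λ j → varV i -P varV j) (laterNbhd G i)))
    vertexPart = eDegree-prodP-0 k (λ j → varV i -P varV j)
      (λ j → eDegree--P k (eDegree-varV k i) (eDegree-varV k j)) (laterNbhd G i)

    edgePart : EDegreeAtMost k (edgeMultiplicity i)
                 (prodP (map (λ e → varV i -P varE e) (edgeNbhd G i)))
    edgePart = eDegree-prodP-map k (λ e → indicator (k ≟ e)) (λ e → varV i -P varE e)
      (λ e → eDegree--P k (eDegree-mono k z≤n (eDegree-varV k i)) (eDegree-varE k e))
      (edgeNbhd G i)

    constantPart : EDegreeAtMost k 0 (prodP (map (λ l → varV i -P constP (+ l)) thresholds))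
    constantPart = eDegree-prodP-0 k (λ l → varV i -P constP (+ l))
      (λ l → eDegree--P k (eDegree-varV k i) (eDegree-constP k (+ l)))
      thresholds

  edgeMultiplicity-≤ : ∀ i → edgeMultiplicity i ≤
                       indicator (proj₁ (ends k) ≟ i) + indicator (proj₂ (ends k) ≟ i)
  edgeMultiplicity-≤ i =
    ≤-trans (sum-allFin-indicator-filter-≤ k (incident? G i))
            (indicator-⊎-dec-≤ (proj₁ (ends k) ≟ i) (proj₂ (ends k) ≟ i))

  sum-edgeMultiplicity-≤ : sum (map edgeMultiplicity (allFin n)) ≤ 2
  sum-edgeMultiplicity-≤ = begin
    sum (map edgeMultiplicity (allFin n))
      ≤⟨ sum-map-mono-≤ edgeMultiplicity-≤ (allFin n) ⟩
    sum (map (λ i → atEnd₁ i + atEnd₂ i) (allFin n))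
      ≡⟨ sum-map-+ atEnd₁ atEnd₂ (allFin n) ⟩
    sum (map atEnd₁ (allFin n)) + sum (map atEnd₂ (allFin n))
      ≡⟨ cong₂ _+_ (sum-allFin-indicator-≟ (proj₁ (ends k)))
                   (sum-allFin-indicator-≟ (proj₂ (ends k))) ⟩
    2 ∎
    where
    open ≤-Reasoning
    atEnd₁ atEnd₂ : Fin n → ℕ
    atEnd₁ i = indicator (proj₁ (ends k) ≟ i)
    atEnd₂ i = indicator (proj₂ (ends k) ≟ i)

  eDegree-bigP : ∀ p → EDegreeAtMost k 2 (bigP G p)
  eDegree-bigP p = eDegree-mono k sum-edgeMultiplicity-≤
    (eDegree-prodP-map k edgeMultiplicity (vertexFactor G p) (eDegree-vertexFactor p) (allFin n))

lemma1 : (n m : ℕ) (G : SimpleGraph n m) (p : ℕ) → Prime p →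
    m * m * (2 * maxDegree G + 2) ≤ p →
    (ls : Vec ℕ n) (k : Fin m) (β : Vec ℕ m) → 2 < lookup β k →
    (+ p) ∣ coeff (reduce p (bigP G p)) (ls , β)
lemma1 n m G p _ _ ls k β 2<βk =
  subst ((+ p) ∣_) (sym (coeff-≡0 k (eDegree-reduce k p (eDegree-bigP G k p)) ls β 2<βk)) (p ∣0)
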